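{- Let $\Theta$ be a standard s-substitution and $t$ a standard term. Then for all states $p$ over the parameters of $\Theta$ and $t$ and all parameter assignments $\sigma\in\mathcal S(p)$ we have $\sigma(\psi_p(t)){\downarrow}\,\psi_p(\Theta)[\sigma]=\sigma(\psi_p(t)\psi_p(\Theta)){\downarrow}$.
   Context: Parameters range over natural numbers; numerals are $\bar0,\bar1=s(\bar0),\bar2,\ldots$; a parameter assignment $\sigma$ maps parameters to numerals and evaluates terms built from $\bar0$, parameters, $s$ and $p$ (predecessor, $p(\bar0)=\bar0$). For $k\ge1$, a $k$-ary variable class $X$ is a set of first-order variables $X(\nu_1,\ldots,\nu_k)$ indexed bijectively by $k$-tuples of numerals (distinct classes disjoint); $X(r_1,\ldots,r_k)$ with numeric terms $r_i$ is a variable expression, $\sigma(X(r_1,\ldots,r_k)){\downarrow}=X(\sigma(r_1){\downarrow},\ldots,\sigma(r_k){\downarrow})$. Schematic individual terms are built from constants, variables, variable expressions, first-order function symbols and primitive-recursively defined schematic term symbols $\hat t(s_1,\ldots,s_i,r_1,\ldots,r_j)$; $\sigma(t){\downarrow}$ is the first-order term obtained by evaluating under $\sigma$ and unfolding definitions. Each variable class $X$ of arity $k$ has a fixed parameter list $(m_1,\ldots,m_k)$; $X(r_1,\ldots,r_k)$ is standard if each $r_i\in\{m_i,\bar0,p(m_i),s(m_i)\}$; a standard term has only standard variable expressions. Two variable expressions are parameter-unifiable if some $\sigma$ evaluates them to the same variable. A standard s-substitution is $\Theta=\{A_1\leftarrow t_1,\ldots,A_\gamma\leftarrow t_\gamma\}$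 with $A_i$ standard variable expressions, $t_i$ standard terms, and $A_i,A_j$ not parameter-unifiable for $i\neq j$; $\Theta[\sigma]=\{\sigma(A_i){\downarrow}\leftarrow\sigma(t_i){\downarrow}\}_i$ (a first-order substitution). A state over a finite parameter set $\mathcal P$ is a conjunction choosing for each $m\in\mathcal P$ one of: $m=\bar0$; $m\neq\bar0\wedge p(m)=\bar0$; $m\neq\bar0\wedge p(m)\neq\bar0$; $\mathcal S(p)$ is the set of assignments satisfying $p$. $\psi_p$ on a standard variable expression $X(r_1,\ldots,r_k)$ with list $(m_1,\ldots,m_k)$: for each $i$, if $p$ contains $m_i=\bar0$, replace $r_i\in\{m_i,p(m_i),\bar0\}$ by $\bar0$ and $s(m_i)$ by $\bar1$; if $p$ contains $m_i\neq\bar0\wedge p(m_i)=\bar0$, replace $p(m_i)$ by $\bar0$, $m_i$ by $\bar1$, $s(m_i)$ by $\bar2$, leave $\bar0$; otherwise leave $r_i$. $\psi_p$ fixes constants and ordinary variables, is homomorphic over function symbols and individual arguments of schematic symbols (numeric arguments unchanged), and $\psi_p(\Theta)=\{\psi_p(A_i)\leftarrow\psi_p(t_i)\}_i$. For a term $u$ and a set $\Delta=\{B_1\leftarrow u_1,\ldots\}$ with variable expressions $B_j$, $u\Delta$ denotes syntactic application: every occurrence in $u$ of a variable expression syntactically identical to some $B_j$ is replaced by $u_j$ (including inside individual arguments of schematic symbols). For a first-order term $w$ and first-order substitution $\tau$, $w\tau$ is ordinary application. -}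

module Defs where

open import Data.Nat using (ℕ; zero; suc; pred; _≤_)
open import Data.Nat.Properties using () renaming (_≟_ to _≟ℕ_)
open import Data.Fin using (Fin)
open import Data.Vec using (Vec; []; _∷_; lookup)
open import Data.Vec.Properties using () renaming (≡-dec to vec-dec)
open import Data.Vec.Relation.Unary.All using () renaming (All to VAll)
open import Data.Vec.Relation.Binary.Pointwise.Inductive using (Pointwise)
open import Data.List using (List; []; _∷_; _++_; map)
open import Data.List.Membership.Propositional using (_∈_)
open import Data.List.Membership.DecPropositional _≟ℕ_ using (_∈?_)
open import Data.List.Relation.Unary.All using (All)
open import Data.List.Relation.Unary.AllPairs using (AllPairs)
open import Data.Product using (Σ; _×_; _,_; proj₁; proj₂; ∃)
open import Data.Sum using (_⊎_; inj₁; inj₂)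
open import Relation.Binary.PropositionalEquality using (_≡_; _≢_; refl; cong; cong₂)
open import Relation.Binary.Definitions using (DecidableEquality)
open import Data.Unit using (⊤; tt)
import Data.Unit
open import Relation.Nullary using (¬_; Dec; yes; no)

data NTerm : Set where
  n0  : NTerm
  par : ℕ → NTerm
  ns  : NTerm → NTerm
  np  : NTerm → NTerm

Assignment : Set
Assignment = ℕ → ℕ

evalN : Assignment → NTerm → ℕ
evalN σ n0      = zero
evalN σ (par m) = σ m
evalN σ (ns r)  = suc (evalN σ r)
evalN σ (np r)  = pred (evalN σ r)

ns-inj : ∀ {a b} → ns a ≡ ns b → a ≡ b
ns-inj refl = refl

np-inj : ∀ {a b} → np a ≡ np b → a ≡ b
np-inj refl = refl

par-inj : ∀ {a b} → par a ≡ par b → a ≡ b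
par-inj refl = refl

_≟N_ : DecidableEquality NTerm
n0 ≟N n0 = yes refl
n0 ≟N par _ = no (λ ())
n0 ≟N ns _ = no (λ ())
n0 ≟N np _ = no (λ ())
par _ ≟N n0 = no (λ ())
par a ≟N par b with a ≟ℕ b
... | yes refl = yes refl
... | no ne = no (λ e → ne (par-inj e))
par _ ≟N ns _ = no (λ ())
par _ ≟N np _ = no (λ ())
ns _ ≟N n0 = no (λ ())
ns _ ≟N par _ = no (λ ())
ns a ≟N ns b with a ≟N b
... | yes refl = yes refl
... | no ne = no (λ e → ne (ns-inj e))
ns _ ≟N np _ = no (λ ())
np _ ≟N n0 = no (λ ())
np _ ≟N par _ = no (λ ())
np _ ≟N ns _ = no (λ ())
np a ≟N np b with a ≟N b
... | yes refl = yes refl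
... | no ne = no (λ e → ne (np-inj e))

-- Variable classes are named by natural numbers (so distinct
-- classes are disjoint by construction); class X has arity ar X ≥ 1 and a
-- fixed parameter list plist X.  Schematic term symbols have individual
-- arity iar and numeric arity nar; their (primitive recursive) definitions
-- are represented by what unfolding them yields: for given numeral values
-- of the numeric arguments, a first-order term over the formal individual
-- arguments.

record FSig : Set₁ where
  field
    Con    : Set
    Fun    : Set
    farity : Fun → ℕ
open FSig public

data Tm (F : FSig) (V : Set) : Set where
  var   : V → Tm F V
  const : Con F → Tm F V
  fn    : (f : Fun F) → Vec (Tm F V) (farity F f) → Tm F V

record Sig : Set₁ where
  field
    fsig   : FSig
    OVar   : Set
    ar     : ℕ → ℕ
    ar-pos : ∀ X → 1 ≤ ar X
    plist  : (X : ℕ) → Vec ℕ (ar X)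
    Sch    : Set
    iar    : Sch → ℕ
    nar    : Sch → ℕ
    unfold : (h : Sch) → Vec ℕ (nar h) → Tm fsig (Fin (iar h))
  open FSig fsig public

open Sig public

module _ {F : FSig} {V W : Set} where
  mutual
    bind : (V → Tm F W) → Tm F V → Tm F W
    bind θ (var x)   = θ x
    bind θ (const c) = const c
    bind θ (fn f ts) = fn f (bindV θ ts)

    bindV : ∀ {n} → (V → Tm F W) → Vec (Tm F V) n → Vec (Tm F W) n
    bindV θ []       = []
    bindV θ (t ∷ ts) = bind θ t ∷ bindV θ ts

CVar : Sig → Set
CVar S = Σ ℕ (λ X → Vec ℕ (ar S X))

_≟CV_ : ∀ {S} → DecidableEquality (CVar S)
(X , νs) ≟CV (Y , μs) with X ≟ℕ Y
... | no ne = no (λ e → ne (cong proj₁ e))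
... | yes refl with vec-dec _≟ℕ_ νs μs
...   | yes refl = yes refl
...   | no ne = no (λ { refl → ne refl })

FOVar : Sig → Set
FOVar S = OVar S ⊎ CVar S

FOTerm : Sig → Set
FOTerm S = Tm (fsig S) (FOVar S)

FOSubst : Sig → Set
FOSubst S = List (CVar S × FOTerm S)

lookupSub : ∀ {S} → FOSubst S → CVar S → FOTerm S
lookupSub []              x = var (inj₂ x)
lookupSub {S} ((y , u) ∷ τ) x with _≟CV_ {S} x y
... | yes _ = u
... | no  _ = lookupSub {S} τ x

substVar : ∀ {S} → FOSubst S → FOVar S → FOTerm S
substVar τ (inj₁ v) = var (inj₁ v)
substVar {S} τ (inj₂ x) = lookupSub {S} τ x

_·_ : ∀ {S} → FOTerm S → FOSubst S → FOTerm S
_·_ {S} w τ = bind (substVar {S} τ) w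

VExp : Sig → Set
VExp S = Σ ℕ (λ X → Vec NTerm (ar S X))

_≟VE_ : ∀ {S} → DecidableEquality (VExp S)
(X , rs) ≟VE (Y , qs) with X ≟ℕ Y
... | no ne = no (λ e → ne (cong proj₁ e))
... | yes refl with vec-dec _≟N_ rs qs
...   | yes refl = yes refl
...   | no ne = no (λ { refl → ne refl })

data STerm (S : Sig) : Set where
  sconst : Con S → STerm S
  sovar  : OVar S → STerm S
  svexp  : VExp S → STerm S
  sfn    : (f : Fun S) → Vec (STerm S) (farity S f) → STerm S
  ssch   : (h : Sch S) → Vec (STerm S) (iar S h) → Vec NTerm (nar S h) → STerm S

module _ {S : Sig} where

  evalVE : Assignment → VExp S → CVar S
  evalVE σ (X , rs) = X , Data.Vec.map (evalN σ) rs

  mutual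
    eval : Assignment → STerm S → FOTerm S
    eval σ (sconst c)     = const c
    eval σ (sovar v)      = var (inj₁ v)
    eval σ (svexp A)      = var (inj₂ (evalVE σ A))
    eval σ (sfn f ts)     = fn f (evalV σ ts)
    eval σ (ssch h ts rs) =
      bind (lookup (evalV σ ts)) (unfold S h (Data.Vec.map (evalN σ) rs))

    evalV : ∀ {n} → Assignment → Vec (STerm S) n → Vec (FOTerm S) n
    evalV σ []       = []
    evalV σ (t ∷ ts) = eval σ t ∷ evalV σ ts

  SSubst : Set
  SSubst = List (VExp S × STerm S)

  _[_] : SSubst → Assignment → FOSubst S
  Θ [ σ ] = map (λ { (A , t) → evalVE σ A , eval σ t }) Θ

  lookupΔ : SSubst → VExp S → STerm S
  lookupΔ []              A = svexp A
  lookupΔ ((B , u) ∷ Δ) A with _≟VE_ {S} A B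
  ... | yes _ = u
  ... | no  _ = lookupΔ Δ A

  mutual
    synApp : STerm S → SSubst → STerm S
    synApp (sconst c)     Δ = sconst c
    synApp (sovar v)      Δ = sovar v
    synApp (svexp A)      Δ = lookupΔ Δ A
    synApp (sfn f ts)     Δ = sfn f (synAppV ts Δ)
    synApp (ssch h ts rs) Δ = ssch h (synAppV ts Δ) rs

    synAppV : ∀ {n} → Vec (STerm S) n → SSubst → Vec (STerm S) n
    synAppV []       Δ = []
    synAppV (t ∷ ts) Δ = synApp t Δ ∷ synAppV ts Δ

  data StdIdx (m : ℕ) : NTerm → Set where
    std-m : StdIdx m (par m)
    std-0 : StdIdx m n0
    std-p : StdIdx m (np (par m))
    std-s : StdIdx m (ns (par m))

  StdVE : VExp S → Set
  StdVE (X , rs) = Pointwise StdIdx (plist S X) rs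

  data StdTerm : STerm S → Set where
    st-const : ∀ c → StdTerm (sconst c)
    st-ovar  : ∀ v → StdTerm (sovar v)
    st-vexp  : ∀ {A} → StdVE A → StdTerm (svexp A)
    st-fn    : ∀ {f ts} → VAll StdTerm ts → StdTerm (sfn f ts)
    st-sch   : ∀ {h ts rs} → VAll StdTerm ts → StdTerm (ssch h ts rs)

  ParamUnifiable : VExp S → VExp S → Set
  ParamUnifiable A B = ∃ λ (σ : Assignment) → evalVE σ A ≡ evalVE σ B

  StdSSubst : SSubst → Set
  StdSSubst Θ =
    All (λ { (A , t) → StdVE A × StdTerm t }) Θ ×
    AllPairs (λ a b → ¬ ParamUnifiable (proj₁ a) (proj₁ b)) Θ

  paramsN : NTerm → List ℕ
  paramsN n0      = []
  paramsN (par m) = m ∷ []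
  paramsN (ns r)  = paramsN r
  paramsN (np r)  = paramsN r

  paramsNV : ∀ {n} → Vec NTerm n → List ℕ
  paramsNV []       = []
  paramsNV (r ∷ rs) = paramsN r ++ paramsNV rs

  mutual
    paramsT : STerm S → List ℕ
    paramsT (sconst c)     = []
    paramsT (sovar v)      = []
    paramsT (svexp (X , rs)) = paramsNV rs
    paramsT (sfn f ts)     = paramsTV ts
    paramsT (ssch h ts rs) = paramsTV ts ++ paramsNV rs

    paramsTV : ∀ {n} → Vec (STerm S) n → List ℕ
    paramsTV []       = []
    paramsTV (t ∷ ts) = paramsT t ++ paramsTV ts

  paramsΘ : SSubst → List ℕ
  paramsΘ []              = []
  paramsΘ (((X , rs) , t) ∷ Θ) = paramsNV rs ++ paramsT t ++ paramsΘ Θ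

data Choice : Set where
  isZero : Choice
  isOne  : Choice
  isBig  : Choice

-- a state: a conjunction over the parameters in dom, choosing choice m
-- for each m ∈ dom (values of choice outside dom are irrelevant)
record State : Set where
  field
    dom    : List ℕ
    choice : ℕ → Choice
open State public

Sat : Assignment → ℕ → Choice → Set
Sat σ m isZero = σ m ≡ zero
Sat σ m isOne  = σ m ≢ zero × pred (σ m) ≡ zero
Sat σ m isBig  = σ m ≢ zero × pred (σ m) ≢ zero

_∈𝒮_ : Assignment → State → Set
σ ∈𝒮 p = ∀ m → m ∈ dom p → Sat σ m (choice p m)

litOf : State → ℕ → Choice ⊎ Data.Unit.⊤
litOf p m with m ∈? dom p
... | yes _ = inj₁ (choice p m)
... | no  _ = inj₂ Data.Unit.tt

ψidx : State → ℕ → NTerm → NTerm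
ψidx p m r = go (litOf p m) r
  where
  go : Choice ⊎ Data.Unit.⊤ → NTerm → NTerm
  go (inj₁ isZero) n0 = n0
  go (inj₁ isZero) (par k) with k ≟ℕ m
  ... | yes _ = n0
  ... | no  _ = par k
  go (inj₁ isZero) (np (par k)) with k ≟ℕ m
  ... | yes _ = n0
  ... | no  _ = np (par k)
  go (inj₁ isZero) (ns (par k)) with k ≟ℕ m
  ... | yes _ = ns n0
  ... | no  _ = ns (par k)
  go (inj₁ isOne) (par k) with k ≟ℕ m
  ... | yes _ = ns n0
  ... | no  _ = par k
  go (inj₁ isOne) (np (par k)) with k ≟ℕ m
  ... | yes _ = n0
  ... | no  _ = np (par k)
  go (inj₁ isOne) (ns (par k)) with k ≟ℕ m
  ... | yes _ = ns (ns n0)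
  ... | no  _ = ns (par k)
  go _ r = r

module _ {S : Sig} where

  ψidxs : State → ∀ {k} → Vec ℕ k → Vec NTerm k → Vec NTerm k
  ψidxs p []       []       = []
  ψidxs p (m ∷ ms) (r ∷ rs) = ψidx p m r ∷ ψidxs p ms rs

  ψVE : State → VExp S → VExp S
  ψVE p (X , rs) = X , ψidxs p (plist S X) rs

  mutual
    ψ : State → STerm S → STerm S
    ψ p (sconst c)     = sconst c
    ψ p (sovar v)      = sovar v
    ψ p (svexp A)      = svexp (ψVE p A)
    ψ p (sfn f ts)     = sfn f (ψV p ts)
    ψ p (ssch h ts rs) = ssch h (ψV p ts) rs

    ψV : State → ∀ {n} → Vec (STerm S) n → Vec (STerm S) n
    ψV p []       = []
    ψV p (t ∷ ts) = ψ p t ∷ ψV p ts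

  ψΘ : State → SSubst {S} → SSubst {S}
  ψΘ p Θ = map (λ { (A , t) → ψVE p A , ψ p t }) Θ

{-# OPTIONS --safe #-}
-- Under σ ∈ 𝒮(p), evaluation by σ is injective on ψ_p-images of standard variable
-- expressions whose parameters lie in p. If p fixes σ(m) ∈ {0, 1}, then ψ_p replaces
-- every standard index of m by the numeral of its value; otherwise σ(m) ≥ 2, and the
-- values 0, σ(m) − 1, σ(m), σ(m) + 1 of the four standard indices are distinct. Hence the
-- first entry of ψ_p(Θ)[σ] whose key is σ(ψ_p(A))↓ comes from the first entry of ψ_p(Θ)
-- whose key is ψ_p(A), and the identity follows by induction on t.
module Submission where

open import Defs
open import Function using (_∘_)
open import Data.Nat using (ℕ; zero; suc; pred)
open import Data.Nat.Properties using (_≟_; ≟-diag; ≡-irrelevant; 1+n≢n; <⇒≢; m<n⇒m<1+n; n<1+n)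
open import Data.Fin using (Fin)
open import Data.Vec using (Vec; []; _∷_; lookup)
import Data.Vec
open import Data.Vec.Properties using (∷-injective)
open import Data.Vec.Relation.Unary.All using () renaming (All to VAll; [] to []ᵛ; _∷_ to _∷ᵛ_)
open import Data.Vec.Relation.Binary.Pointwise.Inductive using (Pointwise; []; _∷_)
open import Data.List using (List; []; _∷_; _++_)
open import Data.List.Relation.Unary.All using (All; []; _∷_)
import Data.List.Relation.Unary.All as All
open import Data.List.Relation.Unary.Any using (here)
open import Data.List.Membership.Propositional using (_∈_)
open import Data.List.Membership.DecPropositional _≟_ using (_∈?_)
open import Data.List.Relation.Binary.Subset.Propositional using (_⊆_)
open import Data.List.Relation.Binary.Subset.Propositional.Properties using (⊆-trans; xs⊆xs++ys; xs⊆ys++xs)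
open import Data.Product using (_×_; _,_; proj₁; proj₂)
open import Data.Product.Properties using (,-injectiveˡ; ,-injectiveʳ-UIP)
open import Data.Sum using (_⊎_; inj₁; inj₂)
open import Relation.Nullary using (yes; no; contradiction)
open import Relation.Binary.PropositionalEquality
  using (_≡_; _≢_; refl; cong; cong₂; sym; trans; module ≡-Reasoning)

module _ {A : Set} {xs ys zs : List A} where

  ++⊆⇒⊆ˡ : xs ++ ys ⊆ zs → xs ⊆ zs
  ++⊆⇒⊆ˡ = ⊆-trans (xs⊆xs++ys xs ys)

  ++⊆⇒⊆ʳ : xs ++ ys ⊆ zs → ys ⊆ zs
  ++⊆⇒⊆ʳ = ⊆-trans (xs⊆ys++xs ys xs)

module _ {F : FSig} where

  mutual
    bind-cong : ∀ {V W} {f g : V → Tm F W} → (∀ x → f x ≡ g x) → ∀ u → bind f u ≡ bind g u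
    bind-cong f≗g (var x)   = f≗g x
    bind-cong f≗g (const c) = refl
    bind-cong f≗g (fn k us) = cong (fn k) (bindV-cong f≗g us)

    bindV-cong : ∀ {V W n} {f g : V → Tm F W} → (∀ x → f x ≡ g x) →
                 (us : Vec (Tm F V) n) → bindV f us ≡ bindV g us
    bindV-cong f≗g []       = refl
    bindV-cong f≗g (u ∷ us) = cong₂ _∷_ (bind-cong f≗g u) (bindV-cong f≗g us)

  mutual
    bind-bind : ∀ {U V W} (θ : V → Tm F W) (φ : U → Tm F V) u →
                bind θ (bind φ u) ≡ bind (bind θ ∘ φ) u
    bind-bind θ φ (var x)   = refl
    bind-bind θ φ (const c) = refl
    bind-bind θ φ (fn k us) = cong (fn k) (bindV-bind θ φ us)

    bindV-bind : ∀ {U V W n} (θ : V → Tm F W) (φ : U → Tm F V) (us : Vec (Tm F U) n) →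
                 bindV θ (bindV φ us) ≡ bindV (bind θ ∘ φ) us
    bindV-bind θ φ []       = refl
    bindV-bind θ φ (u ∷ us) = cong₂ _∷_ (bind-bind θ φ u) (bindV-bind θ φ us)

  bind-lookup : ∀ {V W n} (θ : V → Tm F W) (us : Vec (Tm F V) n) (i : Fin n) →
                bind θ (lookup us i) ≡ lookup (bindV θ us) i
  bind-lookup θ (u ∷ us) Fin.zero    = refl
  bind-lookup θ (u ∷ us) (Fin.suc i) = bind-lookup θ us i

module _ {S : Sig} where

  data EveryVExp (P : VExp S → Set) : STerm S → Set where
    ev-const : ∀ c → EveryVExp P (sconst c)
    ev-ovar  : ∀ v → EveryVExp P (sovar v)
    ev-vexp  : ∀ {A} → P A → EveryVExp P (svexp A)
    ev-fn    : ∀ {f ts} → VAll (EveryVExp P) ts → EveryVExp P (sfn f ts)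
    ev-sch   : ∀ {h ts rs} → VAll (EveryVExp P) ts → EveryVExp P (ssch h ts rs)

  Separates : Assignment → VExp S → SSubst {S} → Set
  Separates σ A Δ = All (λ B←u → evalVE {S} σ A ≡ evalVE {S} σ (proj₁ B←u) → A ≡ proj₁ B←u) Δ

  module _ (σ : Assignment) where

    lookupSub-evalVE : ∀ A Δ → Separates σ A Δ →
                       lookupSub {S} (Δ [ σ ]) (evalVE {S} σ A) ≡ eval σ (lookupΔ Δ A)
    lookupSub-evalVE A []            []            = refl
    lookupSub-evalVE A ((B , u) ∷ Δ) (sepB ∷ sepΔ)
      with _≟CV_ {S} (evalVE {S} σ A) (evalVE {S} σ B) | _≟VE_ {S} A B
    ... | yes _     | yes _    = refl
    ... | no σA≢σB  | yes refl = contradiction refl σA≢σB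
    ... | yes σA≡σB | no A≢B   = contradiction (sepB σA≡σB) A≢B
    ... | no _      | no _     = lookupSub-evalVE A Δ sepΔ

    mutual
      eval-synApp : ∀ Δ {u} → EveryVExp (λ A → Separates σ A Δ) u →
                    _·_ {S} (eval σ u) (Δ [ σ ]) ≡ eval σ (synApp u Δ)
      eval-synApp Δ (ev-const c)      = refl
      eval-synApp Δ (ev-ovar v)       = refl
      eval-synApp Δ (ev-vexp {A} sep) = lookupSub-evalVE A Δ sep
      eval-synApp Δ (ev-fn {f} evs)   = cong (fn f) (evalV-synAppV Δ evs)
      eval-synApp Δ (ev-sch {h} {ts} {rs} evs) = begin
          bind θ (bind (lookup (evalV σ ts)) U)
        ≡⟨ bind-bind θ (lookup (evalV σ ts)) U ⟩
          bind (bind θ ∘ lookup (evalV σ ts)) U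
        ≡⟨ bind-cong (λ i → trans (bind-lookup θ (evalV σ ts) i)
                                  (cong (λ us → lookup us i) (evalV-synAppV Δ evs))) U ⟩
          bind (lookup (evalV σ (synAppV ts Δ))) U
        ∎
        where
        open ≡-Reasoning
        θ : FOVar S → FOTerm S
        θ = substVar {S} (Δ [ σ ])
        U : Tm (fsig S) (Fin (iar S h))
        U = unfold S h (Data.Vec.map (evalN σ) rs)

      evalV-synAppV : ∀ Δ {n} {us : Vec (STerm S) n} → VAll (EveryVExp (λ A → Separates σ A Δ)) us →
                      bindV (substVar {S} (Δ [ σ ])) (evalV σ us) ≡ evalV σ (synAppV us Δ)
      evalV-synAppV Δ []ᵛ          = refl
      evalV-synAppV Δ (ev ∷ᵛ evs) = cong₂ _∷_ (eval-synApp Δ ev) (evalV-synAppV Δ evs)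

numeral : ℕ → NTerm
numeral zero    = n0
numeral (suc n) = ns (numeral n)

evalN-numeral : ∀ σ n → evalN σ (numeral n) ≡ n
evalN-numeral σ zero    = refl
evalN-numeral σ (suc n) = cong suc (evalN-numeral σ n)

evalN-numeral-injective : ∀ σ {a b} → evalN σ (numeral a) ≡ evalN σ (numeral b) →
                          numeral a ≡ numeral b
evalN-numeral-injective σ {a} {b} e =
  cong numeral (trans (sym (evalN-numeral σ a)) (trans e (evalN-numeral σ b)))

module _ {S : Sig} where

  stdValue : ∀ {m r} → StdIdx {S} m r → ℕ → ℕ
  stdValue std-0 n = 0
  stdValue std-p n = pred n
  stdValue std-m n = n
  stdValue std-s n = suc n

  evalN-stdIdx : ∀ σ {m r} (sr : StdIdx {S} m r) → evalN σ r ≡ stdValue sr (σ m)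
  evalN-stdIdx σ std-0 = refl
  evalN-stdIdx σ std-p = refl
  evalN-stdIdx σ std-m = refl
  evalN-stdIdx σ std-s = refl

  stdValue-injective : ∀ {n m r q} → n ≢ 0 → pred n ≢ 0 → (sr : StdIdx {S} m r) (sq : StdIdx {S} m q) →
                       stdValue sr n ≡ stdValue sq n → r ≡ q
  stdValue-injective {zero}        n≢0 _ _ _ _ = contradiction refl n≢0
  stdValue-injective {suc zero}    _ n≢1 _ _ _ = contradiction refl n≢1
  stdValue-injective {suc (suc k)} _ _ = distinct
    where
    distinct : ∀ {m r q} (sr : StdIdx {S} m r) (sq : StdIdx {S} m q) →
               stdValue sr (suc (suc k)) ≡ stdValue sq (suc (suc k)) → r ≡ q
    distinct std-0 std-0 _ = refl
    distinct std-p std-p _ = refl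
    distinct std-m std-m _ = refl
    distinct std-s std-s _ = refl
    distinct std-0 std-p ()
    distinct std-0 std-m ()
    distinct std-0 std-s ()
    distinct std-p std-0 ()
    distinct std-m std-0 ()
    distinct std-s std-0 ()
    distinct std-p std-m e = contradiction (sym e) 1+n≢n
    distinct std-m std-p e = contradiction e 1+n≢n
    distinct std-m std-s e = contradiction (sym e) 1+n≢n
    distinct std-s std-m e = contradiction e 1+n≢n
    distinct std-p std-s e = contradiction e (<⇒≢ (m<n⇒m<1+n (n<1+n (suc k))))
    distinct std-s std-p e = contradiction (sym e) (<⇒≢ (m<n⇒m<1+n (n<1+n (suc k))))

  normIdx : ∀ {m r} → Choice → StdIdx {S} m r → NTerm
  normIdx isZero sr = numeral (stdValue sr 0)
  normIdx isOne  sr = numeral (stdValue sr 1)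
  normIdx {r = r} isBig _  = r

  normIdx-evalN-injective : ∀ σ {m r q} c → Sat σ m c → (sr : StdIdx {S} m r) (sq : StdIdx {S} m q) →
                            evalN σ (normIdx c sr) ≡ evalN σ (normIdx c sq) → normIdx c sr ≡ normIdx c sq
  normIdx-evalN-injective σ isZero _ _ _ = evalN-numeral-injective σ
  normIdx-evalN-injective σ isOne  _ _ _ = evalN-numeral-injective σ
  normIdx-evalN-injective σ isBig (σm≢0 , σm≢1) sr sq e =
    stdValue-injective σm≢0 σm≢1 sr sq (trans (sym (evalN-stdIdx σ sr)) (trans e (evalN-stdIdx σ sq)))

  litOf-∈ : ∀ {p m} → m ∈ dom p → litOf p m ≡ inj₁ (choice p m)
  litOf-∈ {p} {m} m∈p with m ∈? dom p
  ... | yes _   = refl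
  ... | no m∉p = contradiction m∈p m∉p

  ψidx-normIdx : ∀ {p m r} → m ∈ dom p → (sr : StdIdx {S} m r) → ψidx p m r ≡ normIdx (choice p m) sr
  ψidx-normIdx {p} {m} m∈p sr rewrite litOf-∈ {p} m∈p with choice p m | sr
  ... | isZero | std-0 = refl
  ... | isZero | std-m rewrite ≟-diag {m} refl = refl
  ... | isZero | std-p rewrite ≟-diag {m} refl = refl
  ... | isZero | std-s rewrite ≟-diag {m} refl = refl
  ... | isOne  | std-0 = refl
  ... | isOne  | std-m rewrite ≟-diag {m} refl = refl
  ... | isOne  | std-p rewrite ≟-diag {m} refl = refl
  ... | isOne  | std-s rewrite ≟-diag {m} refl = refl
  ... | isBig  | _     = refl

  StdVEOver : State → VExp S → Set
  StdVEOver p A = StdVE {S} A × paramsNV {S} (proj₂ A) ⊆ dom p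

  stdIdx-n0-or-param : ∀ {m r} → StdIdx {S} m r → r ≡ n0 ⊎ m ∈ paramsN {S} r
  stdIdx-n0-or-param std-0 = inj₁ refl
  stdIdx-n0-or-param std-m = inj₂ (here refl)
  stdIdx-n0-or-param std-p = inj₂ (here refl)
  stdIdx-n0-or-param std-s = inj₂ (here refl)

  module _ {p : State} {σ : Assignment} (σ∈p : σ ∈𝒮 p) where

    ψidx-evalN-injective-∈ : ∀ {m r q} → m ∈ dom p → (sr : StdIdx {S} m r) (sq : StdIdx {S} m q) →
                             evalN σ (ψidx p m r) ≡ evalN σ (ψidx p m q) → ψidx p m r ≡ ψidx p m q
    ψidx-evalN-injective-∈ {m} {r} {q} m∈p sr sq e = begin
        ψidx p m r               ≡⟨ ψr≡ ⟩
        normIdx (choice p m) sr  ≡⟨ normIdx-evalN-injective σ (choice p m) (σ∈p m m∈p) sr sq σ-eq ⟩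
        normIdx (choice p m) sq  ≡⟨ sym ψq≡ ⟩
        ψidx p m q               ∎
      where
      open ≡-Reasoning
      ψr≡ : ψidx p m r ≡ normIdx (choice p m) sr
      ψr≡ = ψidx-normIdx m∈p sr
      ψq≡ : ψidx p m q ≡ normIdx (choice p m) sq
      ψq≡ = ψidx-normIdx m∈p sq
      σ-eq : evalN σ (normIdx (choice p m) sr) ≡ evalN σ (normIdx (choice p m) sq)
      σ-eq = trans (cong (evalN σ) (sym ψr≡)) (trans e (cong (evalN σ) ψq≡))

    ψidx-evalN-injective : ∀ {m r q} (sr : StdIdx {S} m r) (sq : StdIdx {S} m q) →
                           paramsN {S} r ⊆ dom p → paramsN {S} q ⊆ dom p →
                           evalN σ (ψidx p m r) ≡ evalN σ (ψidx p m q) → ψidx p m r ≡ ψidx p m q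
    ψidx-evalN-injective sr sq r⊆p q⊆p e with stdIdx-n0-or-param sr | stdIdx-n0-or-param sq
    ... | inj₁ refl | inj₁ refl = refl
    ... | inj₂ m∈r  | _         = ψidx-evalN-injective-∈ (r⊆p m∈r) sr sq e
    ... | inj₁ _    | inj₂ m∈q  = ψidx-evalN-injective-∈ (q⊆p m∈q) sr sq e

    ψidxs-evalN-injective : ∀ {k} {ms : Vec ℕ k} {rs qs} →
                            Pointwise (StdIdx {S}) ms rs → Pointwise (StdIdx {S}) ms qs →
                            paramsNV {S} rs ⊆ dom p → paramsNV {S} qs ⊆ dom p →
                            Data.Vec.map (evalN σ) (ψidxs {S} p ms rs) ≡
                            Data.Vec.map (evalN σ) (ψidxs {S} p ms qs) →
                            ψidxs {S} p ms rs ≡ ψidxs {S} p ms qs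
    ψidxs-evalN-injective [] [] _ _ _ = refl
    ψidxs-evalN-injective (sr ∷ srs) (sq ∷ sqs) rs⊆p qs⊆p e =
      cong₂ _∷_
        (ψidx-evalN-injective sr sq (++⊆⇒⊆ˡ rs⊆p) (++⊆⇒⊆ˡ qs⊆p) (proj₁ (∷-injective e)))
        (ψidxs-evalN-injective srs sqs (++⊆⇒⊆ʳ rs⊆p) (++⊆⇒⊆ʳ qs⊆p) (proj₂ (∷-injective e)))

    ψVE-evalVE-injective : ∀ {A B} → StdVEOver p A → StdVEOver p B →
                           evalVE {S} σ (ψVE {S} p A) ≡ evalVE {S} σ (ψVE {S} p B) →
                           ψVE {S} p A ≡ ψVE {S} p B
    ψVE-evalVE-injective {X , _} (sA , A⊆p) (sB , B⊆p) e with refl ← ,-injectiveˡ e =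
      cong (X ,_) (ψidxs-evalN-injective sA sB A⊆p B⊆p (,-injectiveʳ-UIP ≡-irrelevant e))

    ψΘ-separates : ∀ Θ → All (StdVE {S} ∘ proj₁) Θ → paramsΘ {S} Θ ⊆ dom p →
                   ∀ {A} → StdVEOver p A → Separates σ (ψVE {S} p A) (ψΘ {S} p Θ)
    ψΘ-separates []                    []         _    _  = []
    ψΘ-separates (((Y , qs) , u) ∷ Θ) (sB ∷ sΘ) Θ⊆p sA =
      ψVE-evalVE-injective sA (sB , ++⊆⇒⊆ˡ Θ⊆p)
      ∷ ψΘ-separates Θ sΘ (++⊆⇒⊆ʳ (++⊆⇒⊆ʳ {xs = paramsNV {S} qs} Θ⊆p)) sA

  module _ {p : State} {P : VExp S → Set} (ψ-P : ∀ {A} → StdVEOver p A → P (ψVE {S} p A)) where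

    mutual
      ψ-everyVExp : ∀ {t} → StdTerm {S} t → paramsT {S} t ⊆ dom p → EveryVExp P (ψ p t)
      ψ-everyVExp (st-const c) _    = ev-const c
      ψ-everyVExp (st-ovar v)  _    = ev-ovar v
      ψ-everyVExp (st-vexp sA) A⊆p  = ev-vexp (ψ-P (sA , A⊆p))
      ψ-everyVExp (st-fn sts)  ts⊆p = ev-fn (ψV-everyVExp sts ts⊆p)
      ψ-everyVExp (st-sch sts) ⊆p   = ev-sch (ψV-everyVExp sts (++⊆⇒⊆ˡ ⊆p))

      ψV-everyVExp : ∀ {n} {ts : Vec (STerm S) n} → VAll (StdTerm {S}) ts → paramsTV {S} ts ⊆ dom p →
                     VAll (EveryVExp P) (ψV p ts)
      ψV-everyVExp []ᵛ         _    = []ᵛ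
      ψV-everyVExp (st ∷ᵛ sts) ⊆p = ψ-everyVExp st (++⊆⇒⊆ˡ ⊆p) ∷ᵛ ψV-everyVExp sts (++⊆⇒⊆ʳ ⊆p)

lemma2 : (S : Sig) (Θ : SSubst {S}) (t : STerm S) →
    StdSSubst Θ → StdTerm t →
    (p : State) →
    (∀ m → (m ∈ dom p → m ∈ paramsΘ Θ ++ paramsT t) × (m ∈ paramsΘ Θ ++ paramsT t → m ∈ dom p)) →
    (σ : Assignment) → σ ∈𝒮 p →
    _·_ {S} (eval σ (ψ p t)) (ψΘ p Θ [ σ ]) ≡ eval σ (synApp (ψ p t) (ψΘ p Θ))
lemma2 S Θ t (stdΘ , _) st p dom-p σ σ∈p =
  eval-synApp σ (ψΘ p Θ) (ψ-everyVExp (ψΘ-separates σ∈p Θ (All.map proj₁ stdΘ) Θ⊆p) st t⊆p)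
  where
  covered : paramsΘ Θ ++ paramsT t ⊆ dom p
  covered = proj₂ (dom-p _)
  Θ⊆p : paramsΘ Θ ⊆ dom p
  Θ⊆p = ++⊆⇒⊆ˡ covered
  t⊆p : paramsT t ⊆ dom p
  t⊆p = ++⊆⇒⊆ʳ {xs = paramsΘ Θ} covered
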